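{- Let $m$ be a positive integer and $k$ an integer with $0\le k\le 2^m-1$. The number of pairs $(A_1,A_2)$ of strings of length $m$ with Conway number $C(A_2,A_1)=k$ is equal to the number of strings $A$ of length $2m$ whose autocorrelation $C(A,A)$ is congruent to $k$ modulo $2^m$ (i.e., whose binary representation, as an $2m$-bit string, ends in the $m$ binary bits of $k$, padded with leading zeros). Moreover, if $X$ and $Y$ are strings of length less than $m$, the same conclusion holds when one counts only pairs with $X$ a prefix of $A_1$ and $Y$ a suffix of $A_2$, and only strings $A$ with $X$ a prefix of $A$ and $Y$ a suffix of $A$.
   Context: Strings are finite strings over $\{H,T\}$. For strings $A=a_1\dots a_n$, $B=b_1\dots b_n$ of the same length $n$, the Conway number (correlation) is $C(A,B)=\sum_{i=1}^n\delta_i2^{n-i}$, where $\delta_i=1$ if $a_{i+j}=b_{1+j}$ for all $j=0,\dots,n-i$ (i.e. the last $n-i+1$ letters of $A$ equal the first $n-i+1$ letters of $B$) and $\delta_i=0$ otherwise. The autocorrelation of $A$ is $C(A,A)$, regarded also as the $n$-bit string $\delta_1\dots\delta_n$. -}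

module Defs where

open import Data.Nat using (ℕ; zero; suc; _+_; _*_; _∸_; _^_; _%_)
open import Data.Nat.Properties using (m^n≢0)
open import Data.List using (List; []; _∷_; length; take; drop; map; concatMap; filter; cartesianProduct)
open import Data.List.Properties using (≡-dec)
open import Data.Product using (_×_; _,_; proj₁; proj₂)
open import Relation.Binary.PropositionalEquality using (_≡_; refl)
open import Relation.Nullary using (Dec; yes; no; does)
open import Relation.Unary using (Pred; Decidable)
import Agda.Primitive
open import Data.Bool using (if_then_else_)

data Coin : Set where
  H T : Coin

_≟C_ : (a b : Coin) → Dec (a ≡ b)
H ≟C H = yes refl
H ≟C T = no (λ ())
T ≟C H = no (λ ())
T ≟C T = yes refl

Str : Set
Str = List Coin

_≟S_ : (a b : Str) → Dec (a ≡ b)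
_≟S_ = ≡-dec _≟C_

strings : ℕ → List Str
strings zero = [] ∷ []
strings (suc n) = concatMap (λ s → (H ∷ s) ∷ (T ∷ s) ∷ []) (strings n)

IsPrefix : Str → Str → Set
IsPrefix X A = take (length X) A ≡ X

IsSuffix : Str → Str → Set
IsSuffix Y A = drop (length A ∸ length Y) A ≡ Y

-- For |A| = |B| = n, suffix of length n-i+1 gets weight 2^(n-i),
-- exactly δ_i 2^(n-i) as in the Conway number.
corr : Str → Str → ℕ
corr [] B = 0
corr (a ∷ as) B =
  (if does (take (length (a ∷ as)) B ≟S (a ∷ as)) then 2 ^ length as else 0)
  + corr as B

-- Conway number C(A,B) (meaningful for |A| = |B|)
C : Str → Str → ℕ
C A B = corr A B

count : {A : Set} {P : Pred A Agda.Primitive.lzero} → Decidable P → List A → ℕ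
count P? xs = length (filter P? xs)

pairs : ℕ → List (Str × Str)
pairs m = cartesianProduct (strings m) (strings m)

pairCount : ℕ → ℕ → Str → Str → ℕ
pairCount m k X Y = count P? (pairs m)
  where
  P? : (p : Str × Str) → Dec ((C (proj₂ p) (proj₁ p) ≡ k) × IsPrefix X (proj₁ p) × IsSuffix Y (proj₂ p))
  P? (A₁ , A₂) with C A₂ A₁ Data.Nat.≟ k | take (length X) A₁ ≟S X | drop (length A₂ ∸ length Y) A₂ ≟S Y
  ... | yes a | yes b | yes c = yes (a , b , c)
  ... | no a | _ | _ = no (λ z → a (proj₁ z))
  ... | yes _ | no b | _ = no (λ z → b (proj₁ (proj₂ z)))
  ... | yes _ | yes _ | no c = no (λ z → c (proj₂ (proj₂ z)))

autoCount : ℕ → ℕ → Str → Str → ℕ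
autoCount m k X Y = count P? (strings (2 * m))
  where
  instance _ = m^n≢0 2 m
  P? : (A : Str) → Dec ((C A A % 2 ^ m ≡ k) × IsPrefix X A × IsSuffix Y A)
  P? A with (C A A % 2 ^ m) Data.Nat.≟ k | take (length X) A ≟S X | drop (length A ∸ length Y) A ≟S Y
  ... | yes a | yes b | yes c = yes (a , b , c)
  ... | no a | _ | _ = no (λ z → a (proj₁ z))
  ... | yes _ | no b | _ = no (λ z → b (proj₁ (proj₂ z)))
  ... | yes _ | yes _ | no c = no (λ z → c (proj₂ (proj₂ z)))

{-# OPTIONS --safe #-}

-- Cutting a string A of length 2m into halves p and s is a bijection between such strings
-- and pairs (p , s) of length-m strings.  The suffixes of A of length > m contribute
-- multiples of 2^m to C(A,A), so C(A,A) mod 2^m is the sum over the suffixes of s that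
-- are prefixes of A; as these have length ≤ m they are prefixes of A exactly when they
-- are prefixes of p, which makes C(A,A) mod 2^m = C(s,p).  Prefix and suffix conditions
-- of length ≤ m only look at p resp. s, so the two counts agree.

module Submission where

open import Defs
open import Level using (0ℓ)
open import Data.Nat using (ℕ; zero; suc; _+_; _*_; _∸_; _^_; _%_; _≤_; _<_; z≤n; s≤s)
open import Data.Nat.Properties
  using (+-identityʳ; +-assoc; +-comm; *-distribʳ-+; ^-distribˡ-+-*; +-∸-assoc; +-monoʳ-<;
         m≤m+n; n≤1+n; ≤-refl; ≤-reflexive; ≤-trans; <⇒≤; m≤n⇒m⊓n≡m; m^n≢0; +-commutativeSemigroup)
open import Data.Nat.DivMod using ([m+kn]%n≡m%n; m<n⇒m%n≡m)
open import Algebra.Properties.CommutativeSemigroup +-commutativeSemigroup using (interchange)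
open import Data.Nat.ListAction using (sum)
open import Data.Nat.ListAction.Properties using (sum-++)
open import Data.List using (List; []; _∷_; _++_; length; take; drop; map; concatMap; cartesianProduct)
open import Data.List.Properties using (length-++; map-++; map-∘; map-cong; take-take; take-all)
open import Data.Product using (_×_; _,_; proj₁; proj₂; ∃-syntax)
open import Data.Product.Function.NonDependent.Propositional using (_×-⇔_)
open import Data.Bool using (true; false; if_then_else_)
open import Function using (_∘_; flip)
open import Function.Bundles using (_⇔_; mk⇔)
open import Relation.Binary.PropositionalEquality using (_≡_; refl; sym; trans; cong; cong₂; subst; module ≡-Reasoning)
open import Relation.Nullary using (Dec; does)
open import Relation.Nullary.Decidable using (does-⇔)
open import Relation.Unary using (Pred; Decidable)

private
  variable
    A B : Set

≡ˡ-⇔ : {x y z : A} → x ≡ y → (x ≡ z) ⇔ (y ≡ z)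
≡ˡ-⇔ x≡y = mk⇔ (trans (sym x≡y)) (trans x≡y)

sum-map-+ : (f g : A → ℕ) (xs : List A) →
  sum (map (λ x → f x + g x) xs) ≡ sum (map f xs) + sum (map g xs)
sum-map-+ f g [] = refl
sum-map-+ f g (x ∷ xs) =
  trans (cong (f x + g x +_) (sum-map-+ f g xs)) (interchange (f x) (g x) _ _)

sum-map-0 : (xs : List A) → sum (map (λ _ → 0) xs) ≡ 0
sum-map-0 [] = refl
sum-map-0 (x ∷ xs) = sum-map-0 xs

sum-map-comm : (f : A → B → ℕ) (xs : List A) (ys : List B) →
  sum (map (λ x → sum (map (f x) ys)) xs) ≡ sum (map (λ y → sum (map (flip f y) xs)) ys)
sum-map-comm f [] ys = sym (sum-map-0 ys)
sum-map-comm f (x ∷ xs) ys =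
  trans (cong (sum (map (f x) ys) +_) (sum-map-comm f xs ys)) (sym (sum-map-+ (f x) _ ys))

sum-map-++ : (f : A → ℕ) (xs ys : List A) → sum (map f (xs ++ ys)) ≡ sum (map f xs) + sum (map f ys)
sum-map-++ f xs ys = trans (cong sum (map-++ f xs ys)) (sum-++ (map f xs) (map f ys))

sum-map-concatMap : (f : B → ℕ) (g : A → List B) (xs : List A) →
  sum (map f (concatMap g xs)) ≡ sum (map (λ x → sum (map f (g x))) xs)
sum-map-concatMap f g [] = refl
sum-map-concatMap f g (x ∷ xs) =
  trans (sum-map-++ f (g x) (concatMap g xs)) (cong (sum (map f (g x)) +_) (sum-map-concatMap f g xs))

sum-map-cartesianProduct : (f : A × B → ℕ) (xs : List A) (ys : List B) →
  sum (map f (cartesianProduct xs ys)) ≡ sum (map (λ x → sum (map (λ y → f (x , y)) ys)) xs)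
sum-map-cartesianProduct f [] ys = refl
sum-map-cartesianProduct f (x ∷ xs) ys =
  trans (sum-map-++ f (map (x ,_) ys) (cartesianProduct xs ys))
        (cong₂ _+_ (cong sum (sym (map-∘ ys))) (sum-map-cartesianProduct f xs ys))

indicator : {P : Set} → Dec P → ℕ
indicator P? = if does P? then 1 else 0

indicator-⇔ : {P Q : Set} → P ⇔ Q → (P? : Dec P) (Q? : Dec Q) → indicator P? ≡ indicator Q?
indicator-⇔ P⇔Q P? Q? = cong (λ b → if b then 1 else 0) (does-⇔ P⇔Q P? Q?)

count≡sum-indicator : {P : Pred A 0ℓ} (P? : Decidable P) (xs : List A) →
  count P? xs ≡ sum (map (indicator ∘ P?) xs)
count≡sum-indicator P? [] = refl
count≡sum-indicator P? (x ∷ xs) with does (P? x)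
... | true = cong suc (count≡sum-indicator P? xs)
... | false = count≡sum-indicator P? xs

sum-map-strings-suc : (f : Str → ℕ) (n : ℕ) →
  sum (map f (strings (suc n))) ≡ sum (map (λ s → f (H ∷ s) + (f (T ∷ s) + 0)) (strings n))
sum-map-strings-suc f n = sum-map-concatMap f _ (strings n)

sum-map-strings-cong : (n : ℕ) {f g : Str → ℕ} → (∀ s → length s ≡ n → f s ≡ g s) →
  sum (map f (strings n)) ≡ sum (map g (strings n))
sum-map-strings-cong zero f≡g = cong (_+ 0) (f≡g [] refl)
sum-map-strings-cong (suc n) {f} {g} f≡g = begin
  sum (map f (strings (suc n)))                                 ≡⟨ sum-map-strings-suc f n ⟩
  sum (map (λ s → f (H ∷ s) + (f (T ∷ s) + 0)) (strings n))
    ≡⟨ sum-map-strings-cong n (λ s |s|≡n →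
         cong₂ _+_ (f≡g (H ∷ s) (cong suc |s|≡n)) (cong (_+ 0) (f≡g (T ∷ s) (cong suc |s|≡n)))) ⟩
  sum (map (λ s → g (H ∷ s) + (g (T ∷ s) + 0)) (strings n))   ≡⟨ sym (sum-map-strings-suc g n) ⟩
  sum (map g (strings (suc n)))                                 ∎
  where open ≡-Reasoning

sum-map-strings-+ : (a b : ℕ) (f : Str → ℕ) →
  sum (map f (strings (a + b))) ≡ sum (map (λ s → sum (map (λ p → f (p ++ s)) (strings a))) (strings b))
sum-map-strings-+ zero b f = cong sum (map-cong (λ s → sym (+-identityʳ (f s))) (strings b))
sum-map-strings-+ (suc a) b f =
  trans (sum-map-strings-suc f (a + b))
  (trans (sum-map-strings-+ a b (λ s → f (H ∷ s) + (f (T ∷ s) + 0)))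
         (cong sum (map-cong (λ s → sym (sum-map-strings-suc (λ p → f (p ++ s)) a)) (strings b))))

count-cartesianProduct-strings : (a b : ℕ) {n : ℕ} → a + b ≡ n →
  {P : Pred (Str × Str) 0ℓ} {Q : Pred Str 0ℓ} (P? : Decidable P) (Q? : Decidable Q) →
  (∀ p s → length p ≡ a → length s ≡ b → P (p , s) ⇔ Q (p ++ s)) →
  count P? (cartesianProduct (strings a) (strings b)) ≡ count Q? (strings n)
count-cartesianProduct-strings a b refl P? Q? P⇔Q = begin
  count P? (cartesianProduct (strings a) (strings b))
    ≡⟨ count≡sum-indicator P? (cartesianProduct (strings a) (strings b)) ⟩
  sum (map (indicator ∘ P?) (cartesianProduct (strings a) (strings b)))
    ≡⟨ sum-map-cartesianProduct _ (strings a) (strings b) ⟩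
  sum (map (λ p → sum (map (λ s → indicator (P? (p , s))) (strings b))) (strings a))
    ≡⟨ sum-map-strings-cong a (λ p |p|≡a → sum-map-strings-cong b (λ s |s|≡b →
         indicator-⇔ (P⇔Q p s |p|≡a |s|≡b) (P? (p , s)) (Q? (p ++ s)))) ⟩
  sum (map (λ p → sum (map (λ s → indicator (Q? (p ++ s))) (strings b))) (strings a))
    ≡⟨ sum-map-comm (λ p s → indicator (Q? (p ++ s))) (strings a) (strings b) ⟩
  sum (map (λ s → sum (map (λ p → indicator (Q? (p ++ s))) (strings a))) (strings b))
    ≡⟨ sym (sum-map-strings-+ a b (indicator ∘ Q?)) ⟩
  sum (map (indicator ∘ Q?) (strings (a + b)))
    ≡⟨ sym (count≡sum-indicator Q? (strings (a + b))) ⟩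
  count Q? (strings (a + b)) ∎
  where open ≡-Reasoning

take-++-≤ : ∀ n (xs ys : List A) → n ≤ length xs → take n (xs ++ ys) ≡ take n xs
take-++-≤ zero xs ys _ = refl
take-++-≤ (suc n) (x ∷ xs) ys (s≤s n≤xs) = cong (x ∷_) (take-++-≤ n xs ys n≤xs)

drop-length-++ : ∀ n (xs ys : List A) → drop (length xs + n) (xs ++ ys) ≡ drop n ys
drop-length-++ n [] ys = refl
drop-length-++ n (x ∷ xs) ys = drop-length-++ n xs ys

drop-∸-++ : ∀ {n} (xs ys : List A) → n ≤ length ys →
  drop (length (xs ++ ys) ∸ n) (xs ++ ys) ≡ drop (length ys ∸ n) ys
drop-∸-++ {n = n} xs ys n≤ys = trans
  (cong (λ i → drop i (xs ++ ys)) (trans (cong (_∸ n) (length-++ xs)) (+-∸-assoc (length xs) n≤ys)))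
  (drop-length-++ (length ys ∸ n) xs ys)

corr-take : ∀ n (l B : Str) → length l ≤ n → corr l B ≡ corr l (take n B)
corr-take n [] B _ = refl
corr-take n (a ∷ as) B l≤n =
  cong₂ (λ t c → (if does (t ≟S (a ∷ as)) then 2 ^ length as else 0) + c)
        (sym (trans (take-take (length (a ∷ as)) n B) (cong (λ i → take i B) (m≤n⇒m⊓n≡m l≤n))))
        (corr-take n as B (≤-trans (n≤1+n _) l≤n))

corr<2^length : (l B : Str) → corr l B < 2 ^ length l
corr<2^length [] B = s≤s z≤n
corr<2^length (a ∷ as) B with does (take (length (a ∷ as)) B ≟S (a ∷ as))
... | true = subst (2 ^ length as + corr as B <_) (cong (2 ^ length as +_) (sym (+-identityʳ _)))
                   (+-monoʳ-< (2 ^ length as) (corr<2^length as B))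
... | false = ≤-trans (corr<2^length as B) (m≤m+n (2 ^ length as) _)

corr-++ : (p s B : Str) → ∃[ q ] corr (p ++ s) B ≡ corr s B + q * 2 ^ length s
corr-++ [] s B = 0 , sym (+-identityʳ _)
corr-++ (a ∷ p) s B with corr-++ p s B | does (take (length (a ∷ p ++ s)) B ≟S (a ∷ p ++ s))
... | q , eq | false = q , eq
... | q , eq | true = 2 ^ length p + q , (begin
  2 ^ length (p ++ s) + corr (p ++ s) B
    ≡⟨ cong₂ _+_ (trans (cong (2 ^_) (length-++ p)) (^-distribˡ-+-* 2 (length p) (length s))) eq ⟩
  2 ^ length p * N + (corr s B + q * N)  ≡⟨ +-comm (2 ^ length p * N) _ ⟩
  corr s B + q * N + 2 ^ length p * N    ≡⟨ +-assoc (corr s B) _ _ ⟩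
  corr s B + (q * N + 2 ^ length p * N)  ≡⟨ cong (corr s B +_) (+-comm (q * N) _) ⟩
  corr s B + (2 ^ length p * N + q * N)  ≡⟨ cong (corr s B +_) (sym (*-distribʳ-+ N (2 ^ length p) q)) ⟩
  corr s B + (2 ^ length p + q) * N      ∎)
  where
  open ≡-Reasoning
  N = 2 ^ length s

_mod2^_ : ℕ → ℕ → ℕ
x mod2^ n = (x % 2 ^ n) {{m^n≢0 2 n}}

corr-++-mod2^ : (p s B : Str) → corr (p ++ s) B mod2^ length s ≡ corr s B
corr-++-mod2^ p s B = begin
  corr (p ++ s) B % 2 ^ length s                 ≡⟨ cong (_% 2 ^ length s) eq ⟩
  (corr s B + q * 2 ^ length s) % 2 ^ length s  ≡⟨ [m+kn]%n≡m%n (corr s B) q (2 ^ length s) ⟩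
  corr s B % 2 ^ length s                        ≡⟨ m<n⇒m%n≡m (corr<2^length s B) ⟩
  corr s B                                       ∎
  where
  open ≡-Reasoning
  instance _ = m^n≢0 2 (length s)
  q = proj₁ (corr-++ p s B)
  eq = proj₂ (corr-++ p s B)

C-++-mod2^ : (p s : Str) → length s ≤ length p → C (p ++ s) (p ++ s) mod2^ length s ≡ C s p
C-++-mod2^ p s s≤p = begin
  corr (p ++ s) (p ++ s) mod2^ length s   ≡⟨ corr-++-mod2^ p s (p ++ s) ⟩
  corr s (p ++ s)                         ≡⟨ corr-take (length p) s (p ++ s) s≤p ⟩
  corr s (take (length p) (p ++ s))       ≡⟨ cong (corr s) (take-++-≤ (length p) p s ≤-refl) ⟩
  corr s (take (length p) p)              ≡⟨ cong (corr s) (take-all (length p) p ≤-refl) ⟩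
  corr s p                                ∎
  where open ≡-Reasoning

pairCount≡autoCount : (m k : ℕ) (X Y : Str) → length X ≤ m → length Y ≤ m →
  pairCount m k X Y ≡ autoCount m k X Y
pairCount≡autoCount m k X Y X≤m Y≤m =
  count-cartesianProduct-strings m m (cong (m +_) (sym (+-identityʳ m))) _ _ λ p s |p|≡m |s|≡m →
    ≡ˡ-⇔ (sym (subst (λ n → C (p ++ s) (p ++ s) mod2^ n ≡ C s p) |s|≡m
                      (C-++-mod2^ p s (≤-reflexive (trans |s|≡m (sym |p|≡m))))))
    ×-⇔ ≡ˡ-⇔ (sym (take-++-≤ (length X) p s (≤-trans X≤m (≤-reflexive (sym |p|≡m)))))
    ×-⇔ ≡ˡ-⇔ (sym (drop-∸-++ p s (≤-trans Y≤m (≤-reflexive (sym |s|≡m)))))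

lemma2p4 : (m k : ℕ) → 1 ≤ m → k < 2 ^ m →
    (pairCount m k [] [] ≡ autoCount m k [] [])
    × ((X Y : Str) → length X < m → length Y < m →
         pairCount m k X Y ≡ autoCount m k X Y)
lemma2p4 m k _ _ =
  pairCount≡autoCount m k [] [] z≤n z≤n ,
  λ X Y X<m Y<m → pairCount≡autoCount m k X Y (<⇒≤ X<m) (<⇒≤ Y<m)
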